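{- Let $A<B$ be integers and $k$ a nonnegative integer such that (i) $B-A=2^{k+1}-1$, and (ii) with $M=(A+B-1)/2$, we have $|M|_2\ge k$ and $|x|_2<k$ for every integer $x$ with $A\le x<B$, $x\ne M$. Let $x_1\prec x_2\prec\cdots\prec x_{2^{k+1}-1}$ be the elements of $\{x\in\mathbb{Z}: A\le x<B\}$ sorted increasingly with respect to $\prec$. Then whenever $x_i<M$ for some $1\le i<2^{k+1}-1$, we have $x_{i+1}\ge M$ (comparisons with $M$ in the usual order of $\mathbb{Z}$); i.e., the elements from the left half and from the right half of the interval alternate.
   Context: For an integer $k$ and $l\ge2$, $|k|_l=\sup\{m:\ l^m\mid k\}$ (so $|0|_l=+\infty$). The strict total order $\prec$ on $\mathbb{Z}$ is defined by: $a\prec b$ iff there is a nonnegative integer $i$ with $|a-i|_2<|b-i|_2$ and $|a-j|_2=|b-j|_2$ for all $j\in\{0,\dots,i-1\}$. -}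

module Defs where

open import Data.Nat as ℕ using (ℕ; zero; suc; ⌊_/2⌋; _%_)
open import Data.Integer as ℤ using (ℤ; +_; ∣_∣; _-_)
open import Data.Product using (∃)
open import Relation.Binary.PropositionalEquality using (_≡_)

data ℕ∞ : Set where
  fin : ℕ → ℕ∞
  ∞   : ℕ∞

data _<∞_ : ℕ∞ → ℕ∞ → Set where
  fin<fin : ∀ {m n} → m ℕ.< n → fin m <∞ fin n
  fin<∞   : ∀ {m} → fin m <∞ ∞

data _≤∞_ : ℕ∞ → ℕ∞ → Set where
  fin≤fin : ∀ {m n} → m ℕ.≤ n → fin m ≤∞ fin n
  ≤∞-top  : ∀ {x} → x ≤∞ ∞

val2ℕ : ℕ → ℕ → ℕ
val2ℕ zero    n       = 0
val2ℕ (suc f) zero    = 0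
val2ℕ (suc f) (suc n) with suc n % 2
... | zero  = suc (val2ℕ f ⌊ suc n /2⌋)
... | suc _ = 0

-- |x|_2 = sup{ m : 2^m ∣ x }, so |0|_2 = +∞.
-- (fuel ∣x∣ suffices since the valuation of a positive n is < n)
∣_∣₂ : ℤ → ℕ∞
∣ x ∣₂ with ∣ x ∣
... | zero  = ∞
... | suc n = fin (val2ℕ (suc n) (suc n))

_≺_ : ℤ → ℤ → Set
a ≺ b = ∃ λ (i : ℕ) → (∣ a - + i ∣₂ <∞ ∣ b - + i ∣₂)
          Data.Product.× (∀ (j : ℕ) → j ℕ.< i → ∣ a - + j ∣₂ ≡ ∣ b - + j ∣₂)

-- Put K = 2^k and C = M − K. Then 2^k ∣ C, the interval is C+1, …, C+2K−1, its lower half is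
-- {C+s : 0 < s < K} and its upper half {C+s+K : 0 < s < K}.
-- For lower-half points x ≺ y we have 2^k ∤ x − y, so for no j are both x − j and y − j multiples
-- of 2^k. Hence neither is before the first index i where their valuations differ, and x − i is
-- not one either. Adding K to a non-multiple of 2^k keeps its valuation, so x + K ≺ y, and likewise
-- x ≺ y + K (at i, if 2^k ∣ y − i then both y − i and y + K − i have valuation ≥ k > |x − i|₂).
-- Similarly C+s and C+s+K have equal valuations at every j < s and compare at j = s as |C|₂ and
-- |C+K|₂, exactly one of which exceeds k. So x ≺ x + K ≺ y or x ≺ y + K ≺ y: a point of the upper
-- half lies strictly between x and y in the order ≺, and x, y cannot be consecutive.
module Submission where

open import Defs
open import Data.Empty using (⊥-elim)
open import Data.Integer as ℤ using (ℤ; +_; _+_; _-_; _*_; -_; _≤_; _<_)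
import Data.Integer.DivMod as ℤDM
import Data.Integer.Properties as ℤP
open import Data.Integer.Divisibility.Signed
  using (_∣_; divides; _∣?_; ∣ᵤ⇒∣; ∣⇒∣ᵤ; ∣m∣n⇒∣m+n; ∣m∣n⇒∣m-n; ∣m+n∣m⇒∣n; ∣m+n∣n⇒∣m; ∣-refl; ∣-trans)
open import Data.Integer.Tactic.RingSolver using (solve-∀)
open import Data.Nat as ℕ using (ℕ; zero; suc; _^_; _∸_; ⌊_/2⌋; _%_; s≤s; z≤n)
import Data.Nat.Divisibility as ℕD
import Data.Nat.Properties as ℕP
open import Data.Product using (_×_; ∃; _,_; proj₁)
open import Data.Sum using (_⊎_; inj₁; inj₂)
open import Function.Bundles using (_⇔_; mk⇔; Equivalence)
open import Relation.Binary using (Asymmetric; tri<; tri≈; tri>)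
open import Relation.Binary.PropositionalEquality
open import Relation.Nullary using (¬_; yes; no)
open import Relation.Nullary.Decidable using (decidable-stable)

open Equivalence using (to; from)

variable
  k m n : ℕ
  c x y : ℤ
  a b e : ℕ∞

≤∞-reflexive : a ≡ b → a ≤∞ b
≤∞-reflexive {fin m} refl = fin≤fin ℕP.≤-refl
≤∞-reflexive {∞}     refl = ≤∞-top

≤∞-trans : a ≤∞ b → b ≤∞ e → a ≤∞ e
≤∞-trans (fin≤fin p) (fin≤fin q) = fin≤fin (ℕP.≤-trans p q)
≤∞-trans _           ≤∞-top      = ≤∞-top

≤∞-antisym : a ≤∞ b → b ≤∞ a → a ≡ b
≤∞-antisym (fin≤fin p) (fin≤fin q) = cong fin (ℕP.≤-antisym p q)
≤∞-antisym ≤∞-top      ≤∞-top      = refl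

<∞⇒≤∞ : a <∞ b → a ≤∞ b
<∞⇒≤∞ (fin<fin p) = fin≤fin (ℕP.<⇒≤ p)
<∞⇒≤∞ fin<∞       = ≤∞-top

<∞-irrefl : ¬ a <∞ a
<∞-irrefl (fin<fin p) = ℕP.<-irrefl refl p

<∞-asym : a <∞ b → ¬ b <∞ a
<∞-asym (fin<fin p) (fin<fin q) = ℕP.<-asym p q

<∞-≤∞-trans : a <∞ b → b ≤∞ e → a <∞ e
<∞-≤∞-trans (fin<fin p) (fin≤fin q) = fin<fin (ℕP.<-≤-trans p q)
<∞-≤∞-trans (fin<fin p) ≤∞-top      = fin<∞
<∞-≤∞-trans fin<∞       ≤∞-top      = fin<∞

≰∞⇒>∞ : ¬ fin n ≤∞ a → a <∞ fin n
≰∞⇒>∞ {a = fin m} m≱n = fin<fin (ℕP.≰⇒> (λ n≤m → m≱n (fin≤fin n≤m)))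
≰∞⇒>∞ {a = ∞}     ∞≱n = ⊥-elim (∞≱n ≤∞-top)

≤∞-fromFiniteBounds : (∀ n → fin n ≤∞ a → fin n ≤∞ b) → a ≤∞ b
≤∞-fromFiniteBounds {fin m} bound = bound m (fin≤fin ℕP.≤-refl)
≤∞-fromFiniteBounds {∞} {fin m} bound with bound (suc m) ≤∞-top
... | fin≤fin 1+m≤m = ⊥-elim (ℕP.<-irrefl refl 1+m≤m)
≤∞-fromFiniteBounds {∞} {∞}     bound = ≤∞-top

2^_ : ℕ → ℤ
2^ n = + (2 ^ n)

⌊n*2/2⌋≡n : ∀ n → ⌊ n ℕ.* 2 /2⌋ ≡ n
⌊n*2/2⌋≡n zero    = refl
⌊n*2/2⌋≡n (suc n) = cong suc (⌊n*2/2⌋≡n n)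

even⇒≡2*⌊/2⌋ : ∀ m → m % 2 ≡ 0 → m ≡ 2 ℕ.* ⌊ m /2⌋
even⇒≡2*⌊/2⌋ m m%2≡0 with ℕD.m%n≡0⇒n∣m m 2 m%2≡0
... | ℕD.divides-refl q = trans (ℕP.*-comm q 2) (cong (2 ℕ.*_) (sym (⌊n*2/2⌋≡n q)))

2^∣⇔≤val2ℕ : ∀ {f m} n → 0 ℕ.< m → m ℕ.≤ f → 2 ^ n ℕD.∣ m ⇔ n ℕ.≤ val2ℕ f m
2^∣⇔≤val2ℕ {suc f} {suc m} n _ (s≤s m≤f) with suc m % 2 in m%2
... | zero = even n
  where
  h : ℕ
  h = ⌊ suc m /2⌋
  m≡2h : suc m ≡ 2 ℕ.* h
  m≡2h = even⇒≡2*⌊/2⌋ (suc m) m%2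
  0<h : 0 ℕ.< h
  0<h with h | m≡2h
  ... | suc _ | _ = s≤s z≤n
  h-spec : ∀ n → 2 ^ n ℕD.∣ h ⇔ n ℕ.≤ val2ℕ f h
  h-spec n = 2^∣⇔≤val2ℕ n 0<h (ℕP.≤-trans (ℕP.≤-pred (ℕP.⌊n/2⌋<n m)) m≤f)
  even : ∀ n → 2 ^ n ℕD.∣ suc m ⇔ n ℕ.≤ suc (val2ℕ f h)
  even zero    = mk⇔ (λ _ → z≤n) (λ _ → ℕD.1∣ _)
  even (suc n) = mk⇔
    (λ d → s≤s (to (h-spec n) (ℕD.*-cancelˡ-∣ 2 (subst (2 ^ suc n ℕD.∣_) m≡2h d))))
    (λ { (s≤s p) → subst (2 ^ suc n ℕD.∣_) (sym m≡2h) (ℕD.*-monoʳ-∣ 2 (from (h-spec n) p)) })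
... | suc _ = odd n
  where
  odd : ∀ n → 2 ^ n ℕD.∣ suc m ⇔ n ℕ.≤ 0
  odd zero    = mk⇔ (λ _ → z≤n) (λ _ → ℕD.1∣ _)
  odd (suc n) = mk⇔ (λ d → ⊥-elim (ℕP.0≢1+n (trans (sym (2∣m⇒m%2≡0 d)) m%2))) λ ()
    where
    2∣m⇒m%2≡0 : 2 ^ suc n ℕD.∣ suc m → suc m % 2 ≡ 0
    2∣m⇒m%2≡0 d = ℕD.n∣m⇒m%n≡0 (suc m) 2 (ℕD.∣-trans (ℕD.m∣m*n (2 ^ n)) d)

ν₂ : ℕ → ℕ∞
ν₂ zero        = ∞
ν₂ m@(suc _) = fin (val2ℕ m m)

2^∣⇔≤ν₂ : ∀ n m → 2 ^ n ℕD.∣ m ⇔ fin n ≤∞ ν₂ m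
2^∣⇔≤ν₂ n zero    = mk⇔ (λ _ → ≤∞-top) (λ _ → (2 ^ n) ℕD.∣0)
2^∣⇔≤ν₂ n (suc m) = mk⇔ (λ d → fin≤fin (to spec d)) (λ { (fin≤fin p) → from spec p })
  where
  spec : 2 ^ n ℕD.∣ suc m ⇔ n ℕ.≤ val2ℕ (suc m) (suc m)
  spec = 2^∣⇔≤val2ℕ n (s≤s z≤n) ℕP.≤-refl

∣x∣₂≡ν₂∣x∣ : ∀ x → ∣ x ∣₂ ≡ ν₂ ℤ.∣ x ∣
∣x∣₂≡ν₂∣x∣ x with ℤ.∣ x ∣
... | zero  = refl
... | suc _ = refl

2^∣⇒≤∣∣₂ : 2^ n ∣ x → fin n ≤∞ ∣ x ∣₂
2^∣⇒≤∣∣₂ {n} {x} d = subst (fin n ≤∞_) (sym (∣x∣₂≡ν₂∣x∣ x)) (to (2^∣⇔≤ν₂ n ℤ.∣ x ∣) (∣⇒∣ᵤ d))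

≤∣∣₂⇒2^∣ : fin n ≤∞ ∣ x ∣₂ → 2^ n ∣ x
≤∣∣₂⇒2^∣ {n} {x} p = ∣ᵤ⇒∣ (from (2^∣⇔≤ν₂ n ℤ.∣ x ∣) (subst (fin n ≤∞_) (∣x∣₂≡ν₂∣x∣ x) p))

2^∤⇒∣∣₂< : ¬ 2^ n ∣ x → ∣ x ∣₂ <∞ fin n
2^∤⇒∣∣₂< 2^∤x = ≰∞⇒>∞ (λ p → 2^∤x (≤∣∣₂⇒2^∣ p))

2^∣-mono : ∀ n → 2^ n ∣ x → ∣ x ∣₂ ≤∞ ∣ y ∣₂ → 2^ n ∣ y
2^∣-mono n d x≤y = ≤∣∣₂⇒2^∣ (≤∞-trans (2^∣⇒≤∣∣₂ {n} d) x≤y)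

∣∣₂-mono : (∀ n → 2^ n ∣ x → 2^ n ∣ y) → ∣ x ∣₂ ≤∞ ∣ y ∣₂
∣∣₂-mono f = ≤∞-fromFiniteBounds (λ n p → 2^∣⇒≤∣∣₂ (f n (≤∣∣₂⇒2^∣ p)))

2^-mono-∣ : m ℕ.≤ n → 2^ m ∣ 2^ n
2^-mono-∣ m≤n = ∣ᵤ⇒∣ (2^m∣2^n m≤n)
  where
  2^m∣2^n : m ℕ.≤ n → 2 ^ m ℕD.∣ 2 ^ n
  2^m∣2^n {zero}          _       = ℕD.1∣ _
  2^m∣2^n {suc m} {suc n} (s≤s p) = ℕD.*-monoʳ-∣ 2 (2^m∣2^n p)

2^1+k∤2^k : ∀ k → ¬ 2^ (suc k) ∣ 2^ k
2^1+k∤2^k k d = ℕP.<-irrefl refl (ℕP.<-≤-trans 2^k<2*2^k (ℕD.∣⇒≤ (∣⇒∣ᵤ d)))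
  where
  instance
    2^k≢0 : ℕ.NonZero (2 ^ k)
    2^k≢0 = ℕ.>-nonZero (ℕP.m^n>0 2 k)
  2^k<2*2^k : 2 ^ k ℕ.< 2 ^ suc k
  2^k<2*2^k = ℕP.^-monoʳ-< 2 (s≤s (s≤s z≤n)) (ℕP.n<1+n k)

∣x+2^k∣₂≡∣x∣₂ : ∀ k → ¬ 2^ k ∣ x → ∣ x + 2^ k ∣₂ ≡ ∣ x ∣₂
∣x+2^k∣₂≡∣x∣₂ {x} k 2^k∤x = ≤∞-antisym (∣∣₂-mono ⇒) (∣∣₂-mono ⇐)
  where
  ⇒ : ∀ n → 2^ n ∣ x + 2^ k → 2^ n ∣ x
  ⇒ n d with n ℕP.≤? k
  ... | yes n≤k = ∣m+n∣n⇒∣m d (2^-mono-∣ n≤k)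
  ... | no  n≰k = ⊥-elim (2^k∤x (∣m+n∣n⇒∣m (∣-trans (2^-mono-∣ k≤n) d) ∣-refl))
    where
    k≤n : k ℕ.≤ n
    k≤n = ℕP.<⇒≤ (ℕP.≰⇒> n≰k)
  ⇐ : ∀ n → 2^ n ∣ x → 2^ n ∣ x + 2^ k
  ⇐ n d with n ℕP.≤? k
  ... | yes n≤k = ∣m∣n⇒∣m+n d (2^-mono-∣ n≤k)
  ... | no  n≰k = ⊥-elim (2^k∤x (∣-trans (2^-mono-∣ (ℕP.<⇒≤ (ℕP.≰⇒> n≰k))) d))

2^-suc : ∀ k → 2^ (suc k) ≡ + 2 * 2^ k
2^-suc k = ℤP.pos-* 2 (2 ^ k)

2^∣-parity : ∀ k → 2^ k ∣ c → 2^ (suc k) ∣ c ⊎ 2^ (suc k) ∣ c + 2^ k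
2^∣-parity k (divides q refl)
  with q ℤ.%ℕ 2 | ℤDM.n%ℕd<d q 2 | ℤDM.a≡a%ℕn+[a/ℕn]*n q 2
... | 0 | _ | q≡2h = inj₁ (divides h (begin
  q * 2^ k                   ≡⟨ cong (_* 2^ k) q≡2h ⟩
  (+ 0 + h * + 2) * 2^ k     ≡⟨ even-identity h (2^ k) ⟩
  h * (+ 2 * 2^ k)           ≡⟨ cong (h *_) (sym (2^-suc k)) ⟩
  h * 2^ (suc k)             ∎))
  where
  open ≡-Reasoning
  h : ℤ
  h = q ℤ./ℕ 2
  even-identity : ∀ h K → (+ 0 + h * + 2) * K ≡ h * (+ 2 * K)
  even-identity = solve-∀
... | 1 | _ | q≡2h+1 = inj₂ (divides (h + + 1) (begin
  q * 2^ k + 2^ k                ≡⟨ cong (λ q → q * 2^ k + 2^ k) q≡2h+1 ⟩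
  (+ 1 + h * + 2) * 2^ k + 2^ k  ≡⟨ odd-identity h (2^ k) ⟩
  (h + + 1) * (+ 2 * 2^ k)       ≡⟨ cong ((h + + 1) *_) (sym (2^-suc k)) ⟩
  (h + + 1) * 2^ (suc k)         ∎))
  where
  open ≡-Reasoning
  h : ℤ
  h = q ℤ./ℕ 2
  odd-identity : ∀ h K → (+ 1 + h * + 2) * K + K ≡ (h + + 1) * (+ 2 * K)
  odd-identity = solve-∀
... | suc (suc _) | s≤s (s≤s ()) | _

∣c+2^k∣₂<∣c∣₂ : ∀ k c → 2^ (suc k) ∣ c → ∣ c + 2^ k ∣₂ <∞ ∣ c ∣₂
∣c+2^k∣₂<∣c∣₂ k c d =
  <∞-≤∞-trans (2^∤⇒∣∣₂< {suc k} (λ d′ → 2^1+k∤2^k k (∣m+n∣m⇒∣n d′ d))) (2^∣⇒≤∣∣₂ {suc k} d)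

∣c∣₂<∣c+2^k∣₂ : ∀ k c → 2^ (suc k) ∣ c + 2^ k → ∣ c ∣₂ <∞ ∣ c + 2^ k ∣₂
∣c∣₂<∣c+2^k∣₂ k c d =
  <∞-≤∞-trans (2^∤⇒∣∣₂< {suc k} {c} (λ d′ → 2^1+k∤2^k k (∣m+n∣m⇒∣n d d′))) (2^∣⇒≤∣∣₂ {suc k} d)

∣∧<⇒≡0 : m ℕD.∣ n → n ℕ.< m → n ≡ 0
∣∧<⇒≡0 {n = zero}  _   _   = refl
∣∧<⇒≡0 {n = suc n} m∣n n<m = ⊥-elim (ℕD.>⇒∤ n<m m∣n)

2^∣+m-+n⇒m≡n : ∀ k → m ℕ.< 2 ^ k → n ℕ.< 2 ^ k → 2^ k ∣ + m - + n → m ≡ n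
2^∣+m-+n⇒m≡n {m} {n} k m<2^k n<2^k d =
  ℤP.+-injective (ℤP.i-j≡0⇒i≡j (+ m) (+ n) (ℤP.∣i∣≡0⇒i≡0 (∣∧<⇒≡0 (∣⇒∣ᵤ d) ∣m-n∣<2^k)))
  where
  ∣m-n∣<2^k : ℤ.∣ + m - + n ∣ ℕ.< 2 ^ k
  ∣m-n∣<2^k = subst (ℕ._< 2 ^ k) (cong ℤ.∣_∣ (sym (ℤP.[+m]-[+n]≡m⊖n m n)))
                (ℕP.≤-<-trans (ℤP.∣m⊝n∣≤m⊔n m n) (ℕP.⊔-pres-<m m<2^k n<2^k))

[x+z]-j≡[x-j]+z : ∀ x z j → x + z - j ≡ x - j + z
[x+z]-j≡[x-j]+z = solve-∀

∣x+2^k-j∣₂≡∣x-j∣₂ : ∀ k j → ¬ 2^ k ∣ x - + j → ∣ x + 2^ k - + j ∣₂ ≡ ∣ x - + j ∣₂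
∣x+2^k-j∣₂≡∣x-j∣₂ {x} k j 2^k∤x-j =
  trans (cong ∣_∣₂ ([x+z]-j≡[x-j]+z x (2^ k) (+ j))) (∣x+2^k∣₂≡∣x∣₂ k 2^k∤x-j)

≺-asym : Asymmetric _≺_
≺-asym {x} {y} (i , x<y , x≈y) (i′ , y<x , y≈x) with ℕP.<-cmp i i′
... | tri< i<i′ _ _ = <∞-irrefl (subst (_<∞ ∣ y - + i ∣₂) (sym (y≈x i i<i′)) x<y)
... | tri≈ _ refl _ = <∞-asym x<y y<x
... | tri> _ _ i′<i = <∞-irrefl (subst (_<∞ ∣ x - + i′ ∣₂) (sym (x≈y i′ i′<i)) y<x)

≺-irrefl : ¬ x ≺ x
≺-irrefl {x} x≺x = ≺-asym {x} {x} x≺x x≺x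

module _ (k : ℕ) (x y : ℤ) (2^k∤x-y : ¬ 2^ k ∣ x - y) where

  private
    2^∤x-j : ∀ j → ∣ x - + j ∣₂ ≤∞ ∣ y - + j ∣₂ → ¬ 2^ k ∣ x - + j
    2^∤x-j j ≤ d = 2^k∤x-y (subst (2^ k ∣_) (cancel x y (+ j)) (∣m∣n⇒∣m-n d (2^∣-mono k d ≤)))
      where
      cancel : ∀ x y j → x - j - (y - j) ≡ x - y
      cancel = solve-∀

  ≺⇒+2^≺ : x ≺ y → (x + 2^ k) ≺ y
  ≺⇒+2^≺ (i , x<y , x≈y) =
    i , subst (_<∞ _) (sym (shift i (<∞⇒≤∞ x<y))) x<y
      , λ j j<i → trans (shift j (≤∞-reflexive (x≈y j j<i))) (x≈y j j<i)
    where
    shift : ∀ j → ∣ x - + j ∣₂ ≤∞ ∣ y - + j ∣₂ → ∣ x + 2^ k - + j ∣₂ ≡ ∣ x - + j ∣₂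
    shift j ≤ = ∣x+2^k-j∣₂≡∣x-j∣₂ {x} k j (2^∤x-j j ≤)

  ≺⇒≺+2^ : x ≺ y → x ≺ (y + 2^ k)
  ≺⇒≺+2^ (i , x<y , x≈y) = i , x<y+2^k , x≈y+2^k
    where
    x≈y+2^k : ∀ j → j ℕ.< i → ∣ x - + j ∣₂ ≡ ∣ y + 2^ k - + j ∣₂
    x≈y+2^k j j<i = trans (x≈y j j<i) (sym (∣x+2^k-j∣₂≡∣x-j∣₂ {y} k j 2^k∤y-j))
      where
      2^k∤y-j : ¬ 2^ k ∣ y - + j
      2^k∤y-j d = 2^∤x-j j (≤∞-reflexive (x≈y j j<i))
                    (2^∣-mono k d (≤∞-reflexive (sym (x≈y j j<i))))
    x<y+2^k : ∣ x - + i ∣₂ <∞ ∣ y + 2^ k - + i ∣₂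
    x<y+2^k with 2^ k ∣? y - + i
    ... | no  2^k∤y-i = subst (_ <∞_) (sym (∣x+2^k-j∣₂≡∣x-j∣₂ {y} k i 2^k∤y-i)) x<y
    ... | yes 2^k∣y-i = <∞-≤∞-trans (2^∤⇒∣∣₂< {k} (2^∤x-j i (<∞⇒≤∞ x<y)))
                          (2^∣⇒≤∣∣₂ {k} (subst (2^ k ∣_) (sym ([x+z]-j≡[x-j]+z y (2^ k) (+ i)))
                                        (∣m∣n⇒∣m+n 2^k∣y-i ∣-refl)))

module _ (k : ℕ) {c : ℤ} (2^k∣c : 2^ k ∣ c) {s : ℕ} (s<2^k : s ℕ.< 2 ^ k) where

  private
    2^∤c+s-j : ∀ j → j ℕ.< s → ¬ 2^ k ∣ c + + s - + j
    2^∤c+s-j j j<s d = ℕP.<⇒≢ j<s (sym (2^∣+m-+n⇒m≡n k s<2^k (ℕP.<-trans j<s s<2^k) 2^k∣s-j))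
      where
      cancel : ∀ c s j → c + s - j - c ≡ s - j
      cancel = solve-∀
      2^k∣s-j : 2^ k ∣ + s - + j
      2^k∣s-j = subst (2^ k ∣_) (cancel c (+ s) (+ j)) (∣m∣n⇒∣m-n d 2^k∣c)

    ∣c+s-j∣₂≡∣c+s+2^k-j∣₂ : ∀ j → j ℕ.< s → ∣ c + + s - + j ∣₂ ≡ ∣ c + + s + 2^ k - + j ∣₂
    ∣c+s-j∣₂≡∣c+s+2^k-j∣₂ j j<s = sym (∣x+2^k-j∣₂≡∣x-j∣₂ {c + + s} k j (2^∤c+s-j j j<s))

    [c+s]-s≡c : ∀ c s → c + s - s ≡ c
    [c+s]-s≡c = solve-∀

    [c+s+z]-s≡c+z : ∀ c s z → c + s + z - s ≡ c + z
    [c+s+z]-s≡c+z = solve-∀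

    ∣c+s-s∣₂≡∣c∣₂ : ∣ c + + s - + s ∣₂ ≡ ∣ c ∣₂
    ∣c+s-s∣₂≡∣c∣₂ = cong ∣_∣₂ ([c+s]-s≡c c (+ s))

    ∣c+s+2^k-s∣₂≡∣c+2^k∣₂ : ∣ c + + s + 2^ k - + s ∣₂ ≡ ∣ c + 2^ k ∣₂
    ∣c+s+2^k-s∣₂≡∣c+2^k∣₂ = cong ∣_∣₂ ([c+s+z]-s≡c+z c (+ s) (2^ k))

  c+s≺c+s+2^k : ∣ c ∣₂ <∞ ∣ c + 2^ k ∣₂ → (c + + s) ≺ (c + + s + 2^ k)
  c+s≺c+s+2^k lt = s , subst₂ _<∞_ (sym ∣c+s-s∣₂≡∣c∣₂) (sym ∣c+s+2^k-s∣₂≡∣c+2^k∣₂) lt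
                     , ∣c+s-j∣₂≡∣c+s+2^k-j∣₂

  c+s+2^k≺c+s : ∣ c + 2^ k ∣₂ <∞ ∣ c ∣₂ → (c + + s + 2^ k) ≺ (c + + s)
  c+s+2^k≺c+s lt = s , subst₂ _<∞_ (sym ∣c+s+2^k-s∣₂≡∣c+2^k∣₂) (sym ∣c+s-s∣₂≡∣c∣₂) lt
                     , λ j j<s → sym (∣c+s-j∣₂≡∣c+s+2^k-j∣₂ j j<s)

consecutive⇒nothing-between :
  ∀ {X : Set} {_⊏_ : X → X → Set} {P : X → Set} → Asymmetric _⊏_ →
  (xs : ℕ → X) (N : ℕ) →
  (∀ y → P y → ∃ λ m → m ℕ.< N × xs m ≡ y) →
  (∀ i j → i ℕ.< j → j ℕ.< N → xs i ⊏ xs j) →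
  ∀ i → suc i ℕ.< N → ∀ y → P y → xs i ⊏ y → ¬ y ⊏ xs (suc i)
consecutive⇒nothing-between asym xs N covers increasing i 1+i<N y Py xᵢ⊏y y⊏xᵢ₊₁
  with covers y Py
... | m , m<N , refl with ℕP.<-cmp m i
...   | tri< m<i _ _ = asym xᵢ⊏y (increasing m i m<i (ℕP.<-trans (ℕP.n<1+n i) 1+i<N))
...   | tri≈ _ refl _ = asym xᵢ⊏y xᵢ⊏y
...   | tri> _ _ i<m with ℕP.m≤n⇒m<n∨m≡n i<m
...     | inj₁ 1+i<m = asym y⊏xᵢ₊₁ (increasing (suc i) m 1+i<m m<N)
...     | inj₂ refl  = asym y⊏xᵢ₊₁ y⊏xᵢ₊₁

offset-below : ∀ n → c ≤ x → x < c + + n → ∃ λ s → s ℕ.< n × x ≡ c + + s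
offset-below {c} {x} n c≤x x<c+n = ℤ.∣ x - c ∣ , s<n , x≡c+s
  where
  +s≡x-c : + ℤ.∣ x - c ∣ ≡ x - c
  +s≡x-c = ℤP.0≤i⇒+∣i∣≡i (ℤP.i≤j⇒0≤j-i c≤x)
  x≡c+s : x ≡ c + + ℤ.∣ x - c ∣
  x≡c+s = trans (identity c x) (cong (_+_ c) (sym +s≡x-c))
    where
    identity : ∀ c x → x ≡ c + (x - c)
    identity = solve-∀
  s<n : ℤ.∣ x - c ∣ ℕ.< n
  s<n = ℤP.drop‿+<+ (subst₂ _<_ (sym +s≡x-c) (identity c (+ n)) (ℤP.+-monoˡ-< (- c) x<c+n))
    where
    identity : ∀ c n → c + n - c ≡ n
    identity = solve-∀

2^∤offset-difference : ∀ k {c s₁ s₂} → s₁ ℕ.< 2 ^ k → s₂ ℕ.< 2 ^ k → s₁ ≢ s₂ →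
                        ¬ 2^ k ∣ c + + s₁ - (c + + s₂)
2^∤offset-difference k {c} {s₁} {s₂} s₁<2^k s₂<2^k s₁≢s₂ d =
  s₁≢s₂ (2^∣+m-+n⇒m≡n k s₁<2^k s₂<2^k (subst (2^ k ∣_) (cancel c (+ s₁) (+ s₂)) d))
  where
  cancel : ∀ c s₁ s₂ → c + s₁ - (c + s₂) ≡ s₁ - s₂
  cancel = solve-∀

offset-interleave : ∀ k {c s₁ s₂} → 2^ k ∣ c → s₁ ℕ.< 2 ^ k → s₂ ℕ.< 2 ^ k →
  (c + + s₁) ≺ (c + + s₂) →
  ∃ λ s → s ℕ.< 2 ^ k × (c + + s₁) ≺ (c + + s + 2^ k) × (c + + s + 2^ k) ≺ (c + + s₂)
offset-interleave k {c} {s₁} {s₂} 2^k∣c s₁<2^k s₂<2^k x≺y = interleave (2^∣-parity k 2^k∣c)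
  where
  2^k∤x-y : ¬ 2^ k ∣ c + + s₁ - (c + + s₂)
  2^k∤x-y = 2^∤offset-difference k {c} s₁<2^k s₂<2^k λ { refl → ≺-irrefl {c + + s₁} x≺y }
  interleave : 2^ (suc k) ∣ c ⊎ 2^ (suc k) ∣ c + 2^ k →
    ∃ λ s → s ℕ.< 2 ^ k × (c + + s₁) ≺ (c + + s + 2^ k) × (c + + s + 2^ k) ≺ (c + + s₂)
  interleave (inj₁ 2^1+k∣c) =
    s₂ , s₂<2^k , ≺⇒≺+2^ k (c + + s₁) (c + + s₂) 2^k∤x-y x≺y
       , c+s+2^k≺c+s k 2^k∣c s₂<2^k (∣c+2^k∣₂<∣c∣₂ k c 2^1+k∣c)
  interleave (inj₂ 2^1+k∣c+2^k) =
    s₁ , s₁<2^k , c+s≺c+s+2^k k 2^k∣c s₁<2^k (∣c∣₂<∣c+2^k∣₂ k c 2^1+k∣c+2^k)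
       , ≺⇒+2^≺ k (c + + s₁) (c + + s₂) 2^k∤x-y x≺y

module MidpointInterval {A B M : ℤ} (k : ℕ)
  (B-A≡2^1+k-1 : B - A ≡ + (2 ^ suc k ∸ 1)) (2M≡A+B-1 : + 2 * M ≡ A + B - + 1) where

  open ≡-Reasoning

  C : ℤ
  C = M - 2^ k

  2*2^k≡B-A+1 : + 2 * 2^ k ≡ B - A + + 1
  2*2^k≡B-A+1 = begin
    + 2 * 2^ k                  ≡⟨ sym (2^-suc k) ⟩
    + (2 ^ suc k)               ≡⟨ cong +_ (sym (ℕP.m∸n+n≡m (ℕP.m^n>0 2 (suc k)))) ⟩
    + (2 ^ suc k ∸ 1 ℕ.+ 1)     ≡⟨ ℤP.pos-+ (2 ^ suc k ∸ 1) 1 ⟩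
    + (2 ^ suc k ∸ 1) + + 1     ≡⟨ cong (_+ + 1) (sym B-A≡2^1+k-1) ⟩
    B - A + + 1                 ∎

  B≡M+2^k : B ≡ M + 2^ k
  B≡M+2^k = ℤP.*-cancelˡ-≡ (+ 2) B (M + 2^ k) (begin
    + 2 * B                            ≡⟨ identity A B ⟩
    (A + B - + 1) + (B - A + + 1)      ≡⟨ cong₂ _+_ (sym 2M≡A+B-1) (sym 2*2^k≡B-A+1) ⟩
    + 2 * M + + 2 * 2^ k               ≡⟨ sym (ℤP.*-distribˡ-+ (+ 2) M (2^ k)) ⟩
    + 2 * (M + 2^ k)                   ∎)
    where
    identity : ∀ A B → + 2 * B ≡ (A + B - + 1) + (B - A + + 1)
    identity = solve-∀

  A≡C+1 : A ≡ C + + 1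
  A≡C+1 = begin
    A                           ≡⟨ identity A B ⟩
    (A + B - + 1) - B + + 1     ≡⟨ cong₂ (λ u v → u - v + + 1) (sym 2M≡A+B-1) B≡M+2^k ⟩
    + 2 * M - (M + 2^ k) + + 1  ≡⟨ identity′ M (2^ k) ⟩
    C + + 1                     ∎
    where
    identity : ∀ A B → A ≡ (A + B - + 1) - B + + 1
    identity = solve-∀
    identity′ : ∀ M K → + 2 * M - (M + K) + + 1 ≡ M - K + + 1
    identity′ = solve-∀

  M≡C+2^k : M ≡ C + 2^ k
  M≡C+2^k = identity M (2^ k)
    where
    identity : ∀ M K → M ≡ M - K + K
    identity = solve-∀

  lower-half-offset : A ≤ x → x < M → ∃ λ s → s ℕ.< 2 ^ k × x ≡ C + + s
  lower-half-offset {x} A≤x x<M = offset-below (2 ^ k) C≤x (subst (_ <_) M≡C+2^k x<M)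
    where
    C≤x : C ≤ x
    C≤x = ℤP.≤-trans (ℤP.≤-trans (ℤP.i≤i+j C (+ 1)) (ℤP.≤-reflexive (sym A≡C+1))) A≤x

  upper-offset-in-range : ∀ {s} → s ℕ.< 2 ^ k → A ≤ C + + s + 2^ k × C + + s + 2^ k < B
  upper-offset-in-range {s} s<2^k = A≤y , y<B
    where
    y≡ : C + + s + 2^ k ≡ C + + (s ℕ.+ 2 ^ k)
    y≡ = trans (ℤP.+-assoc C (+ s) (2^ k)) (cong (_+_ C) (sym (ℤP.pos-+ s (2 ^ k))))
    B≡ : B ≡ C + + (2 ^ k ℕ.+ 2 ^ k)
    B≡ = trans B≡M+2^k (trans (identity M (2^ k)) (cong (_+_ C) (sym (ℤP.pos-+ (2 ^ k) (2 ^ k)))))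
      where
      identity : ∀ M K → M + K ≡ M - K + (K + K)
      identity = solve-∀
    A≤y : A ≤ C + + s + 2^ k
    A≤y = subst₂ _≤_ (sym A≡C+1) (sym y≡)
            (ℤP.+-monoʳ-≤ C (ℤ.+≤+ (ℕP.≤-trans (ℕP.m^n>0 2 k) (ℕP.m≤n+m (2 ^ k) s))))
    y<B : C + + s + 2^ k < B
    y<B = subst₂ _<_ (sym y≡) (sym B≡) (ℤP.+-monoʳ-< C (ℤ.+<+ (ℕP.+-monoˡ-< (2 ^ k) s<2^k)))

lemma3 : (A B : ℤ) (k : ℕ) → A < B
    → B - A ≡ + (2 ^ (suc k) ∸ 1)
    → (M : ℤ) → + 2 * M ≡ A + B - + 1
    → fin k ≤∞ ∣ M ∣₂
    → (∀ (x : ℤ) → A ≤ x → x < B → x ≢ M → ∣ x ∣₂ <∞ fin k)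
    → (xs : ℕ → ℤ)
    → (∀ (i : ℕ) → i ℕ.< 2 ^ (suc k) ∸ 1 → A ≤ xs i × xs i < B)
    → (∀ (x : ℤ) → A ≤ x → x < B → ∃ λ (i : ℕ) → i ℕ.< 2 ^ (suc k) ∸ 1 × xs i ≡ x)
    → (∀ (i j : ℕ) → i ℕ.< j → j ℕ.< 2 ^ (suc k) ∸ 1 → xs i ≺ xs j)
    → ∀ (i : ℕ) → suc i ℕ.< 2 ^ (suc k) ∸ 1 → xs i < M → M ≤ xs (suc i)
lemma3 A B k _ B-A≡ M 2M≡ k≤∣M∣₂ _ xs in-range covers increasing i 1+i<N xᵢ<M =
  decidable-stable (M ℤP.≤? xs (suc i)) λ M≰xᵢ₊₁ →
    let s₁ , s₁<2^k , xᵢ≡ = lower-half-offset (proj₁ (in-range i i<N)) xᵢ<M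
        s₂ , s₂<2^k , xᵢ₊₁≡ = lower-half-offset (proj₁ (in-range (suc i) 1+i<N)) (ℤP.≰⇒> M≰xᵢ₊₁)
        s , s<2^k , xᵢ≺y , y≺xᵢ₊₁ =
          offset-interleave k 2^k∣C s₁<2^k s₂<2^k
            (subst₂ _≺_ xᵢ≡ xᵢ₊₁≡ (increasing i (suc i) (ℕP.n<1+n i) 1+i<N))
        y = C + + s + 2^ k
    in nothing-between y (upper-offset-in-range s<2^k)
         (subst (_≺ y) (sym xᵢ≡) xᵢ≺y) (subst (y ≺_) (sym xᵢ₊₁≡) y≺xᵢ₊₁)
  where
  open MidpointInterval {A} {B} {M} k B-A≡ 2M≡
  i<N : i ℕ.< 2 ^ suc k ∸ 1
  i<N = ℕP.<-trans (ℕP.n<1+n i) 1+i<N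
  2^k∣C : 2^ k ∣ C
  2^k∣C = ∣m∣n⇒∣m-n (≤∣∣₂⇒2^∣ {x = M} k≤∣M∣₂) ∣-refl
  nothing-between : ∀ y → A ≤ y × y < B → xs i ≺ y → ¬ y ≺ xs (suc i)
  nothing-between = consecutive⇒nothing-between (λ {u} {v} → ≺-asym {u} {v}) xs (2 ^ suc k ∸ 1)
                      (λ y (A≤y , y<B) → covers y A≤y y<B) increasing i 1+i<N
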